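{- A chip configuration $\sigma$ on $K_n$ satisfies $U^t\sigma=\sigma$ if and only if $u_t(\sigma,v)=u_t(\sigma,w)$ for all vertices $v,w\in[n]$.
   Context: Parallel chip-firing on $K_n$: $\sigma:[n]\to\mathbb{Z}_{\ge0}$, $r(\sigma)=\#\{v:\sigma(v)\ge n\}$, $U\sigma(v)=\sigma(v)+r(\sigma)$ if $\sigma(v)\le n-1$, $U\sigma(v)=\sigma(v)-n+r(\sigma)$ if $\sigma(v)\ge n$. $u_t(\sigma,v)=\#\{0\le s<t: U^s\sigma(v)\ge n\}$ is the number of times $v$ fires during the first $t$ updates; $t\ge0$ is an integer. -}

module Defs where

open import Data.Nat using (ℕ; zero; suc; _+_; _∸_; _≤ᵇ_)
open import Data.Bool using (Bool; true; false; if_then_else_)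
open import Data.Fin using (Fin)
open import Data.List using (List; length; filter; allFin)
open import Data.Nat using (_≤?_)

Config : ℕ → Set
Config n = Fin n → ℕ

r : ∀ {n} → Config n → ℕ
r {n} σ = length (filter (λ v → n ≤? σ v) (allFin n))

U : ∀ {n} → Config n → Config n
U {n} σ v = if n ≤ᵇ σ v then (σ v ∸ n) + r σ else σ v + r σ

iterU : ∀ {n} → ℕ → Config n → Config n
iterU zero    σ = σ
iterU (suc t) σ = iterU t (U σ)

u : ∀ {n} → ℕ → Config n → Fin n → ℕ
u {n} zero    σ v = 0
u {n} (suc t) σ v = (if n ≤ᵇ σ v then 1 else 0) + u t (U σ) v

-- Each firing of v removes n chips from v, and each firing of any vertex adds one chip to
-- every vertex. Hence U^t σ v + n · u_t(σ,v) = σ v + Σ_w u_t(σ,w) for every v, so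
-- U^t σ = σ exactly when n · u_t(σ,v) equals the total number of firings for every v,
-- i.e. exactly when all firing counts agree.
module Submission where

open import Defs
open import Data.Nat using (ℕ; zero; suc; _+_; _*_; _∸_; _≤ᵇ_; _≤?_)
open import Data.Nat.Properties
open import Data.Nat.ListAction using (sum)
open import Data.Nat.Tactic.RingSolver using (solve-∀)
open import Data.Bool using (true; false; if_then_else_; T)
open import Data.Fin using (Fin)
open import Data.List using (List; []; _∷_; length; filter; map; allFin)
open import Data.List.Properties using (length-tabulate)
open import Data.Product using (_×_; _,_)
open import Relation.Nullary using (does)
open import Relation.Unary using (Pred; Decidable)
open import Relation.Binary.PropositionalEquality

indicator : ∀ {a p} {A : Set a} {P : Pred A p} → Decidable P → A → ℕ
indicator P? x = if does (P? x) then 1 else 0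

length-filter≡sum-indicator : ∀ {a p} {A : Set a} {P : Pred A p} (P? : Decidable P) (xs : List A) →
  length (filter P? xs) ≡ sum (map (indicator P?) xs)
length-filter≡sum-indicator P? [] = refl
length-filter≡sum-indicator P? (x ∷ xs) with does (P? x)
... | true  = cong suc (length-filter≡sum-indicator P? xs)
... | false = length-filter≡sum-indicator P? xs

sum-map-+ : ∀ {a} {A : Set a} (f g : A → ℕ) (xs : List A) →
  sum (map (λ x → f x + g x) xs) ≡ sum (map f xs) + sum (map g xs)
sum-map-+ f g [] = refl
sum-map-+ f g (x ∷ xs) = begin
  f x + g x + sum (map (λ x → f x + g x) xs)   ≡⟨ cong (f x + g x +_) (sum-map-+ f g xs) ⟩
  f x + g x + (sum (map f xs) + sum (map g xs)) ≡⟨ +-interchange (f x) (g x) _ _ ⟩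
  f x + sum (map f xs) + (g x + sum (map g xs)) ∎
  where
  open ≡-Reasoning
  +-interchange : ∀ a b c d → a + b + (c + d) ≡ a + c + (b + d)
  +-interchange = solve-∀

sum-map-const : ∀ {a} {A : Set a} {f : A → ℕ} {k : ℕ} → (∀ x → f x ≡ k) → (xs : List A) →
  sum (map f xs) ≡ length xs * k
sum-map-const f≡k [] = refl
sum-map-const f≡k (x ∷ xs) = cong₂ _+_ (f≡k x) (sum-map-const f≡k xs)

total : ∀ {n} → (Fin n → ℕ) → ℕ
total {n} f = sum (map f (allFin n))

total-const : ∀ {n} {f : Fin n → ℕ} {k : ℕ} → (∀ x → f x ≡ k) → total f ≡ n * k
total-const {n} {k = k} f≡k =
  trans (sum-map-const f≡k (allFin n)) (cong (_* k) (length-tabulate {n = n} (λ i → i)))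

-- does (n ≤? m) reduces to n ≤ᵇ m, so u (suc t) σ v is definitionally fires σ v + u t (U σ) v.
fires : ∀ {n} → Config n → Fin n → ℕ
fires {n} σ v = indicator (λ w → n ≤? σ w) v

r≡total-fires : ∀ {n} (σ : Config n) → r σ ≡ total (fires σ)
r≡total-fires {n} σ = length-filter≡sum-indicator (λ w → n ≤? σ w) (allFin n)

U+n*fires : ∀ {n} (σ : Config n) v → U σ v + n * fires σ v ≡ σ v + r σ
U+n*fires {n} σ v with n ≤ᵇ σ v in fired
... | false = trans (cong (σ v + r σ +_) (*-zeroʳ n)) (+-identityʳ _)
... | true  = begin
  σ v ∸ n + r σ + n * 1 ≡⟨ rearrange (σ v ∸ n) (r σ) n ⟩
  σ v ∸ n + n + r σ     ≡⟨ cong (_+ r σ) (m∸n+n≡m (≤ᵇ⇒≤ n (σ v) (subst T (sym fired) _))) ⟩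
  σ v + r σ             ∎
  where
  open ≡-Reasoning
  rearrange : ∀ a b c → a + b + c * 1 ≡ a + c + b
  rearrange = solve-∀

iterU+n*u : ∀ {n} t (σ : Config n) v → iterU t σ v + n * u t σ v ≡ σ v + total (u t σ)
iterU+n*u {n} zero σ v = cong (σ v +_) (sym (total-const {n} {u zero σ} (λ _ → refl)))
iterU+n*u {n} (suc t) σ v = begin
  iterU t (U σ) v + n * (fires σ v + u t (U σ) v)
    ≡⟨ rearrange (iterU t (U σ) v) n (fires σ v) (u t (U σ) v) ⟩
  (iterU t (U σ) v + n * u t (U σ) v) + n * fires σ v
    ≡⟨ cong (_+ n * fires σ v) (iterU+n*u t (U σ) v) ⟩
  (U σ v + total (u t (U σ))) + n * fires σ v
    ≡⟨ +-rightComm (U σ v) _ _ ⟩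
  (U σ v + n * fires σ v) + total (u t (U σ))
    ≡⟨ cong (_+ total (u t (U σ))) (U+n*fires σ v) ⟩
  σ v + r σ + total (u t (U σ))
    ≡⟨ +-assoc (σ v) _ _ ⟩
  σ v + (r σ + total (u t (U σ)))
    ≡⟨ cong (λ k → σ v + (k + total (u t (U σ)))) (r≡total-fires σ) ⟩
  σ v + (total (fires σ) + total (u t (U σ)))
    ≡⟨ cong (σ v +_) (sym (sum-map-+ (fires σ) (u t (U σ)) (allFin n))) ⟩
  σ v + total (u (suc t) σ) ∎
  where
  open ≡-Reasoning
  rearrange : ∀ x n a b → x + n * (a + b) ≡ x + n * b + n * a
  rearrange = solve-∀
  +-rightComm : ∀ a b c → a + b + c ≡ a + c + b
  +-rightComm = solve-∀

fixed⇒n*u≡total : ∀ {n} t (σ : Config n) v → iterU t σ v ≡ σ v → n * u t σ v ≡ total (u t σ)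
fixed⇒n*u≡total {n} t σ v fixed =
  +-cancelˡ-≡ (σ v) _ _ (trans (cong (_+ n * u t σ v) (sym fixed)) (iterU+n*u t σ v))

fixed⇒u-constant : ∀ {n} t (σ : Config n) → (∀ x → iterU t σ x ≡ σ x) → ∀ v w → u t σ v ≡ u t σ w
fixed⇒u-constant {zero} t σ fixed ()
fixed⇒u-constant {suc m} t σ fixed v w = *-cancelˡ-≡ _ _ (suc m)
  (trans (fixed⇒n*u≡total t σ v (fixed v)) (sym (fixed⇒n*u≡total t σ w (fixed w))))

u-constant⇒fixed : ∀ {n} t (σ : Config n) → (∀ v w → u t σ v ≡ u t σ w) → ∀ x → iterU t σ x ≡ σ x
u-constant⇒fixed {n} t σ constant x = +-cancelʳ-≡ (n * u t σ x) _ _ (begin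
  iterU t σ x + n * u t σ x ≡⟨ iterU+n*u t σ x ⟩
  σ x + total (u t σ)       ≡⟨ cong (σ x +_) (total-const (λ v → constant v x)) ⟩
  σ x + n * u t σ x         ∎)
  where open ≡-Reasoning

lemma4p3 : (n t : ℕ) (σ : Config n) →
    (((x : Fin n) → iterU t σ x ≡ σ x) → ((v w : Fin n) → u t σ v ≡ u t σ w))
    × (((v w : Fin n) → u t σ v ≡ u t σ w) → (x : Fin n) → iterU t σ x ≡ σ x)
lemma4p3 n t σ = fixed⇒u-constant t σ , u-constant⇒fixed t σ
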